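{- Let $b>0$ be an integer and let $\gamma=c-\frac{a}{b}$ and $\gamma'=c'-\frac{a'}{b}$ with $c,c'\in\mathbb{Z}$, $a,a'\in\{1,\ldots,b\}$, and $\gamma,\gamma'\notin\mathbb{Z}_{\ge0}$. For every prime $p>b(N_\gamma+N_{\gamma'})+1$ with $p\equiv1\pmod b$ we have: $\mathrm{rem}_p(\gamma)<\mathrm{rem}_p(\gamma')$ if and only if ($a<a'$, or $a=a'$ and $c<c'$).
   Context: For a prime $p$, $\mathrm{rem}_p(x/y)=xy^{ -1}\bmod p\in\{0,\ldots,p-1\}$ for $x,y\in\mathbb{Z}$, $p\nmid y$. For $\delta=e-\frac{f}{b}$ with $e\in\mathbb{Z}$, $f\in\{1,\ldots,b\}$, $\delta\notin\mathbb{Z}_{\geq 0}$, define $N_\delta=\max(e,\lceil\frac{be}{b-f}\rceil)$ if $e\ge1$ and $N_\delta=\max(-e,\lceil\frac{ -be}{f}\rceil)$ if $e\le0$. (In the paper $b$ is the least common denominator of a fixed finite multiset of rationals in $\mathbb{Q}\setminus\mathbb{Z}_{\geq0}$ containing $\gamma,\gamma'$; the condition $\mathrm{rem}_p(\gamma)<\mathrm{rem}_p(\gamma')$ is written $\gamma\prec_p\gamma'$.) -}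

module Defs where

open import Data.Nat using (ℕ; zero; suc; _+_; _*_; _∸_; _<_; _⊔_)
open import Data.Nat.DivMod using (_/_)
open import Data.Integer as ℤ using (ℤ; +_; -[1+_])
open import Data.Integer.Divisibility as ℤD using ()
open import Data.Product using (_×_)

-- ceiling division ⌈ n / d ⌉ on ℕ; the value for d = 0 is an arbitrary
-- junk value (never used under the hypotheses of the theorem).
ceilDiv : ℕ → ℕ → ℕ
ceilDiv n zero    = zero
ceilDiv n (suc k) = (n + k) / suc k

-- N_δ for δ = e - f/b   (b : ℕ, e : ℤ, f : ℕ)
--   e ≥ 1 : max(e, ⌈ b e / (b - f) ⌉)
--   e ≤ 0 : max(-e, ⌈ -b e / f ⌉)
N : ℕ → ℤ → ℕ → ℕ
N b (+ zero)  f = zero ⊔ ceilDiv (b * zero) f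
N b (+ suc k) f = suc k ⊔ ceilDiv (b * suc k) (b ∸ f)
N b -[1+ k ]  f = suc k ⊔ ceilDiv (b * suc k) f

-- rem_p (x / y) = r  : r is x·y⁻¹ mod p, i.e. r ∈ {0,…,p-1} and r·y ≡ x (mod p).
RemP : ℕ → ℤ → ℤ → ℕ → Set
RemP p x y r = r < p × (+ p) ℤD.∣ (x ℤ.- (+ r) ℤ.* y)

-- Write p = 1 + q b.  Then -q is the inverse of b modulo p, so rem_p (c - a/b) is the
-- residue of a q + c.  The bound on p gives N_γ + N_γ' < q, and the definition of N
-- is exactly what makes 0 ≤ a q + c ≤ q b < p, so rem_p γ = a q + c on the nose.
-- Since |c| + |c'| < q, comparing a q + c with a' q + c' is the lexicographic
-- comparison of the base-q digit pairs (a, c) and (a', c').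

module Submission where

open import Defs
open import Data.Nat using (ℕ; _+_; _*_; _∸_; _<_; _≤_; _>_)
open import Data.Nat.Divisibility using (_∣_)
open import Data.Nat.Primality using (Prime)
open import Data.Integer as ℤ using (ℤ; +_)
open import Data.Product using (_×_; ∃)
open import Data.Sum using (_⊎_)
open import Relation.Binary.PropositionalEquality using (_≡_)
open import Relation.Nullary using (¬_)
open import Function.Bundles using (_⇔_)

open import Data.Nat using (zero; suc; z≤n; s≤s; s≤s⁻¹; s<s; s<s⁻¹; >-nonZero)
open import Data.Nat.Properties
open import Data.Nat.DivMod using (_%_; m≡m%n+[m/n]*n; m%n<n)
open import Data.Nat.Divisibility as ℕ∣ using (>⇒∤)
open import Data.Integer using (-[1+_])
import Data.Integer.Properties as ℤP
open import Data.Integer.Divisibility.Signed as ℤ∣ using () renaming (_∣_ to _∣ℤ_)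
open import Data.Integer.Tactic.RingSolver using (solve-∀)
open import Data.Product using (_,_)
open import Data.Product.Function.NonDependent.Propositional using (_×-⇔_)
open import Data.Sum using (inj₁; inj₂)
open import Data.Sum.Function.Propositional using (_⊎-⇔_)
open import Data.Empty using (⊥-elim)
open import Relation.Binary.Definitions using (tri<; tri≈; tri>)
open import Relation.Binary.PropositionalEquality using (refl; sym; trans; cong; subst; subst₂; module ≡-Reasoning)
open import Function.Bundles using (mk⇔)
import Function.Properties.Equivalence as ⇔

m≤n*⌈m/n⌉ : ∀ m n → 0 < n → m ≤ n * ceilDiv m n
m≤n*⌈m/n⌉ m (suc k) _ = +-cancelʳ-≤ k m (suc k * Q) (begin
  m + k                       ≡⟨ m≡m%n+[m/n]*n (m + k) (suc k) ⟩
  (m + k) % suc k + Q * suc k ≤⟨ +-monoˡ-≤ (Q * suc k) (s≤s⁻¹ (m%n<n (m + k) (suc k))) ⟩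
  k + Q * suc k               ≡⟨ +-comm k (Q * suc k) ⟩
  Q * suc k + k               ≡⟨ cong (_+ k) (*-comm Q (suc k)) ⟩
  suc k * Q + k               ∎)
  where
  open ≤-Reasoning
  Q = ceilDiv m (suc k)

⌈m/n⌉≤q⇒m≤n*q : ∀ m n q → 0 < n → ceilDiv m n ≤ q → m ≤ n * q
⌈m/n⌉≤q⇒m≤n*q m n q 0<n ⌈m/n⌉≤q = ≤-trans (m≤n*⌈m/n⌉ m n 0<n) (*-monoʳ-≤ n ⌈m/n⌉≤q)

m≤n*m′ : ∀ m {n} → 0 < n → m ≤ n * m
m≤n*m′ m {n} 0<n = m≤n*m m n {{>-nonZero 0<n}}

-- Splitting c into c ⁺ and c ⁻ keeps all order reasoning in ℕ.
_⁺ : ℤ → ℕ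
(+ n)    ⁺ = n
-[1+ _ ] ⁺ = 0

_⁻ : ℤ → ℕ
(+ _)    ⁻ = 0
-[1+ k ] ⁻ = suc k

⁺≤∣∣ : ∀ c → c ⁺ ≤ ℤ.∣ c ∣
⁺≤∣∣ (+ n)    = ≤-refl
⁺≤∣∣ -[1+ k ] = z≤n

⁻≤∣∣ : ∀ c → c ⁻ ≤ ℤ.∣ c ∣
⁻≤∣∣ (+ n)    = z≤n
⁻≤∣∣ -[1+ k ] = ≤-refl

+[m+c⁺∸c⁻]≡+m+c : ∀ m c → c ⁻ ≤ m → + (m + c ⁺ ∸ c ⁻) ≡ + m ℤ.+ c
+[m+c⁺∸c⁻]≡+m+c m (+ n)    _   = refl
+[m+c⁺∸c⁻]≡+m+c m -[1+ k ] 1+k≤m =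
  trans (cong (λ n → + (n ∸ suc k)) (+-identityʳ m)) (sym (ℤP.⊖-≥ 1+k≤m))

<⇔⁺+⁻<⁺+⁻ : ∀ c c' → c ℤ.< c' ⇔ c ⁺ + c' ⁻ < c' ⁺ + c ⁻
<⇔⁺+⁻<⁺+⁻ (+ n) (+ n') = mk⇔
  (λ { (ℤ.+<+ n<n') → subst₂ _<_ (sym (+-identityʳ n)) (sym (+-identityʳ n')) n<n' })
  (λ n+0<n'+0 → ℤ.+<+ (subst₂ _<_ (+-identityʳ n) (+-identityʳ n') n+0<n'+0))
<⇔⁺+⁻<⁺+⁻ (+ n)      -[1+ k' ] = mk⇔ (λ ()) (λ ())
<⇔⁺+⁻<⁺+⁻ -[1+ k ]  (+ n')     = mk⇔ (λ _ → ≤-trans (s≤s z≤n) (m≤n+m (suc k) n')) (λ _ → ℤ.-<+)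
<⇔⁺+⁻<⁺+⁻ -[1+ k ]  -[1+ k' ]  = mk⇔ (λ { (ℤ.-<- k'<k) → s<s k'<k }) (λ k'<k → ℤ.-<- (s<s⁻¹ k'<k))

∣∣≤N : ∀ b c a → ℤ.∣ c ∣ ≤ N b c a
∣∣≤N b (+ zero)  a = z≤n
∣∣≤N b (+ suc k) a = m≤m⊔n (suc k) (ceilDiv (b * suc k) (b ∸ a))
∣∣≤N b -[1+ k ]  a = m≤m⊔n (suc k) (ceilDiv (b * suc k) a)

Nonnatural : ℕ → ℤ → ℕ → Set
Nonnatural b c a = ¬ (∃ λ (n : ℕ) → c ℤ.* + b ℤ.- + a ≡ + n ℤ.* + b)

γ∉ℕ⇒a<b : ∀ b k a → a ≤ b → Nonnatural b (+ suc k) a → a < b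
γ∉ℕ⇒a<b b k a a≤b γ∉ℕ with m≤n⇒m<n∨m≡n a≤b
... | inj₁ a<b  = a<b
... | inj₂ refl = ⊥-elim (γ∉ℕ (k , [1+k]b-b≡kb (+ k) (+ b)))
  where
  [1+k]b-b≡kb : ∀ k b → (+ 1 ℤ.+ k) ℤ.* b ℤ.- b ≡ k ℤ.* b
  [1+k]b-b≡kb = solve-∀

c⁻≤a*q : ∀ b c a q → 1 ≤ a → a ≤ b → N b c a ≤ q → c ⁻ ≤ a * q
c⁻≤a*q b (+ n)    a q _   _   _   = z≤n
c⁻≤a*q b -[1+ k ] a q 1≤a a≤b N≤q =
  ≤-trans (m≤n*m′ (suc k) (≤-trans 1≤a a≤b))
          (⌈m/n⌉≤q⇒m≤n*q (b * suc k) a q 1≤a (≤-trans (m≤n⊔m (suc k) _) N≤q))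

a*q+0≤q*b : ∀ {a b} q → a ≤ b → a * q + 0 ≤ q * b
a*q+0≤q*b {a} {b} q a≤b =
  ≤-trans (≤-reflexive (+-identityʳ (a * q))) (≤-trans (*-monoˡ-≤ q a≤b) (≤-reflexive (*-comm b q)))

a*q+c⁺≤q*b : ∀ b c a q → 1 ≤ a → a ≤ b → Nonnatural b c a → N b c a ≤ q →
  a * q + c ⁺ ≤ q * b
a*q+c⁺≤q*b b (+ zero)  a q _   a≤b _   _   = a*q+0≤q*b q a≤b
a*q+c⁺≤q*b b -[1+ k ]  a q _   a≤b _   _   = a*q+0≤q*b q a≤b
a*q+c⁺≤q*b b (+ suc k) a q 1≤a a≤b γ∉ℕ N≤q = begin
  a * q + suc k         ≤⟨ +-monoʳ-≤ (a * q) k<[b-a]q ⟩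
  a * q + (b ∸ a) * q   ≡⟨ *-distribʳ-+ q a (b ∸ a) ⟨
  (a + (b ∸ a)) * q     ≡⟨ cong (_* q) (m+[n∸m]≡n a≤b) ⟩
  b * q                 ≡⟨ *-comm b q ⟩
  q * b                 ∎
  where
  open ≤-Reasoning
  k<[b-a]q : suc k ≤ (b ∸ a) * q
  k<[b-a]q = ≤-trans (m≤n*m′ (suc k) (≤-trans 1≤a a≤b))
    (⌈m/n⌉≤q⇒m≤n*q (b * suc k) (b ∸ a) q (m<n⇒0<n∸m (γ∉ℕ⇒a<b b k a a≤b γ∉ℕ)) (≤-trans (m≤n⊔m (suc k) _) N≤q))

multiple-<⇒≡0 : ∀ {p d} → d < p → p ∣ d → d ≡ 0
multiple-<⇒≡0 {d = zero}  _   _   = refl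
multiple-<⇒≡0 {d = suc d} d<p p∣d = ⊥-elim (>⇒∤ d<p p∣d)

≤-residue-unique : ∀ {p i j} → i ≤ j → j < p → p ∣ ℤ.∣ + j ℤ.- + i ∣ → j ≡ i
≤-residue-unique {p} {i} {j} i≤j j<p p∣j-i = ≤-antisym (m∸n≡0⇒m≤n j∸i≡0) i≤j
  where
  ∣j-i∣≡j∸i : ℤ.∣ + j ℤ.- + i ∣ ≡ j ∸ i
  ∣j-i∣≡j∸i = cong ℤ.∣_∣ (trans (ℤP.m-n≡m⊖n j i) (ℤP.⊖-≥ i≤j))
  j∸i≡0 : j ∸ i ≡ 0
  j∸i≡0 = multiple-<⇒≡0 (≤-<-trans (m∸n≤m j i) j<p) (subst (p ∣_) ∣j-i∣≡j∸i p∣j-i)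

residue-unique : ∀ {p m n} → m < p → n < p → p ∣ ℤ.∣ + m ℤ.- + n ∣ → m ≡ n
residue-unique {p} {m} {n} m<p n<p p∣m-n with ≤-total m n
... | inj₁ m≤n = sym (≤-residue-unique m≤n n<p (subst (p ∣_) (ℤP.∣i-j∣≡∣j-i∣ (+ m) (+ n)) p∣m-n))
... | inj₂ n≤m = ≤-residue-unique n≤m m<p p∣m-n

∣1+u*y⇒∣z*y⇒∣z : ∀ {k z} u y → k ∣ℤ + 1 ℤ.+ u ℤ.* y → k ∣ℤ z ℤ.* y → k ∣ℤ z
∣1+u*y⇒∣z*y⇒∣z {k} {z} u y k∣1+uy k∣zy =
  subst (k ∣ℤ_) (z[1+uy]-u[zy]≡z z u y) (ℤ∣.∣m∣n⇒∣m-n (ℤ∣.∣n⇒∣m*n z k∣1+uy) (ℤ∣.∣n⇒∣m*n u k∣zy))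
  where
  z[1+uy]-u[zy]≡z : ∀ z u y → z ℤ.* (+ 1 ℤ.+ u ℤ.* y) ℤ.- u ℤ.* (z ℤ.* y) ≡ z
  z[1+uy]-u[zy]≡z = solve-∀

remP-unique : ∀ {p x y r r'} u → + p ∣ℤ + 1 ℤ.+ u ℤ.* y →
  RemP p x y r → RemP p x y r' → r ≡ r'
remP-unique {p} {x} {y} {r} {r'} u p∣1+uy (r<p , p∣x-ry) (r'<p , p∣x-r'y) =
  residue-unique r<p r'<p (ℤ∣.∣⇒∣ᵤ {+ p} {+ r ℤ.- + r'} (∣1+u*y⇒∣z*y⇒∣z u y p∣1+uy p∣[r-r']y))
  where
  [x-r'y]-[x-ry]≡[r-r']y : ∀ x y r r' → (x ℤ.- r' ℤ.* y) ℤ.- (x ℤ.- r ℤ.* y) ≡ (r ℤ.- r') ℤ.* y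
  [x-r'y]-[x-ry]≡[r-r']y = solve-∀
  p∣[r-r']y : + p ∣ℤ (+ r ℤ.- + r') ℤ.* y
  p∣[r-r']y = subst (+ p ∣ℤ_) ([x-r'y]-[x-ry]≡[r-r']y x y (+ r) (+ r'))
    (ℤ∣.∣m∣n⇒∣m-n (ℤ∣.∣ᵤ⇒∣ {+ p} {x ℤ.- + r' ℤ.* y} p∣x-r'y) (ℤ∣.∣ᵤ⇒∣ {+ p} {x ℤ.- + r ℤ.* y} p∣x-ry))

remP-γ : ∀ {p q} b c a R → + p ≡ + 1 ℤ.+ + q ℤ.* + b → + R ≡ + a ℤ.* + q ℤ.+ c → R < p →
  RemP p (c ℤ.* + b ℤ.- + a) (+ b) R
remP-γ {p} {q} b c a R p≡1+qb R≡aq+c R<p = R<p , ℤ∣.∣⇒∣ᵤ (ℤ∣.divides (ℤ.- + a) (begin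
  (c ℤ.* + b ℤ.- + a) ℤ.- + R ℤ.* + b                    ≡⟨ cong (λ z → (c ℤ.* + b ℤ.- + a) ℤ.- z ℤ.* + b) R≡aq+c ⟩
  (c ℤ.* + b ℤ.- + a) ℤ.- (+ a ℤ.* + q ℤ.+ c) ℤ.* + b    ≡⟨ γ-identity c (+ a) (+ b) (+ q) ⟩
  ℤ.- + a ℤ.* (+ 1 ℤ.+ + q ℤ.* + b)                      ≡⟨ cong (ℤ.- + a ℤ.*_) p≡1+qb ⟨
  ℤ.- + a ℤ.* + p                                        ∎))
  where
  open ≡-Reasoning
  γ-identity : ∀ c a b q → (c ℤ.* b ℤ.- a) ℤ.- (a ℤ.* q ℤ.+ c) ℤ.* b ≡ ℤ.- a ℤ.* (+ 1 ℤ.+ q ℤ.* b)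
  γ-identity = solve-∀

rem-γ : ∀ {p r} b c a q → p ≡ 1 + q * b → 1 ≤ a → a ≤ b → Nonnatural b c a → N b c a ≤ q →
  RemP p (c ℤ.* + b ℤ.- + a) (+ b) r → r + c ⁻ ≡ a * q + c ⁺
rem-γ {p} {r} b c a q p≡1+qb 1≤a a≤b γ∉ℕ N≤q remP-r = begin
  r + c ⁻   ≡⟨ cong (_+ c ⁻) r≡R ⟩
  R + c ⁻   ≡⟨ m∸n+n≡m (≤-trans c⁻≤aq (m≤m+n (a * q) (c ⁺))) ⟩
  a * q + c ⁺ ∎
  where
  open ≡-Reasoning
  R = a * q + c ⁺ ∸ c ⁻
  c⁻≤aq : c ⁻ ≤ a * q
  c⁻≤aq = c⁻≤a*q b c a q 1≤a a≤b N≤q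
  +p≡1+qb : + p ≡ + 1 ℤ.+ + q ℤ.* + b
  +p≡1+qb = trans (cong +_ p≡1+qb) (cong (λ z → + 1 ℤ.+ z) (ℤP.pos-* q b))
  R≡aq+c : + R ≡ + a ℤ.* + q ℤ.+ c
  R≡aq+c = trans (+[m+c⁺∸c⁻]≡+m+c (a * q) c c⁻≤aq) (cong (ℤ._+ c) (ℤP.pos-* a q))
  R<p : R < p
  R<p = subst (R <_) (sym p≡1+qb) (s≤s (≤-trans (m∸n≤m (a * q + c ⁺) (c ⁻)) (a*q+c⁺≤q*b b c a q 1≤a a≤b γ∉ℕ N≤q)))
  r≡R : r ≡ R
  r≡R = remP-unique {x = c ℤ.* + b ℤ.- + a} (+ q) (ℤ∣.∣-reflexive +p≡1+qb) remP-r (remP-γ b c a R +p≡1+qb R≡aq+c R<p)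

*+<*+-lex : ∀ a a' q {x y} → x < q → a < a' → a * q + x < a' * q + y
*+<*+-lex a a' q {x} {y} x<q a<a' = begin-strict
  a * q + x     <⟨ +-monoʳ-< (a * q) x<q ⟩
  a * q + q     ≡⟨ +-comm (a * q) q ⟩
  suc a * q     ≤⟨ *-monoˡ-≤ q a<a' ⟩
  a' * q        ≤⟨ m≤m+n (a' * q) y ⟩
  a' * q + y    ∎
  where open ≤-Reasoning

*+<*+⇔lex : ∀ a a' q {x y} → x < q → y < q →
  a * q + x < a' * q + y ⇔ (a < a' ⊎ (a ≡ a' × x < y))
*+<*+⇔lex a a' q {x} {y} x<q y<q = mk⇔ to from
  where
  to : a * q + x < a' * q + y → a < a' ⊎ (a ≡ a' × x < y)
  to lt with <-cmp a a'
  ... | tri< a<a' _ _    = inj₁ a<a'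
  ... | tri≈ _ refl _    = inj₂ (refl , +-cancelˡ-< (a * q) x y lt)
  ... | tri> _ _ a'<a    = ⊥-elim (<-asym lt (*+<*+-lex a' a q y<q a'<a))
  from : a < a' ⊎ (a ≡ a' × x < y) → a * q + x < a' * q + y
  from (inj₁ a<a')         = *+<*+-lex a a' q x<q a<a'
  from (inj₂ (refl , x<y)) = +-monoʳ-< (a * q) x<y

<⇔+-shift : ∀ {r r' s s' A A' t t'} → r + s ≡ A + t → r' + s' ≡ A' + t' →
  r < r' ⇔ A + (t + s') < A' + (t' + s)
<⇔+-shift {r} {r'} {s} {s'} {A} {A'} {t} {t'} r+s≡A+t r'+s'≡A'+t' =
  mk⇔ (λ r<r' → subst₂ _<_ lhs rhs (+-monoˡ-< (s + s') r<r'))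
      (λ lt → +-cancelʳ-< (s + s') r r' (subst₂ _<_ (sym lhs) (sym rhs) lt))
  where
  open ≡-Reasoning
  lhs : r + (s + s') ≡ A + (t + s')
  lhs = begin
    r + (s + s')  ≡⟨ +-assoc r s s' ⟨
    r + s + s'    ≡⟨ cong (_+ s') r+s≡A+t ⟩
    A + t + s'    ≡⟨ +-assoc A t s' ⟩
    A + (t + s')  ∎
  rhs : r' + (s + s') ≡ A' + (t' + s)
  rhs = begin
    r' + (s + s')  ≡⟨ cong (λ z → r' + z) (+-comm s s') ⟩
    r' + (s' + s)  ≡⟨ +-assoc r' s' s ⟨
    r' + s' + s    ≡⟨ cong (_+ s) r'+s'≡A'+t' ⟩
    A' + t' + s    ≡⟨ +-assoc A' t' s ⟩
    A' + (t' + s)  ∎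

rem-<⇔lex : ∀ {q r r'} a a' c c' → r + c ⁻ ≡ a * q + c ⁺ → r' + c' ⁻ ≡ a' * q + c' ⁺ →
  ℤ.∣ c ∣ + ℤ.∣ c' ∣ < q → r < r' ⇔ (a < a' ⊎ (a ≡ a' × c ℤ.< c'))
rem-<⇔lex {q} a a' c c' eq eq' ∣c∣+∣c'∣<q =
  ⇔.trans (<⇔+-shift {A = a * q} {a' * q} {c ⁺} {c' ⁺} eq eq')
    (⇔.trans (*+<*+⇔lex a a' q x<q y<q) (⇔.refl ⊎-⇔ (⇔.refl ×-⇔ ⇔.sym (<⇔⁺+⁻<⁺+⁻ c c'))))
  where
  x<q : c ⁺ + c' ⁻ < q
  x<q = ≤-<-trans (+-mono-≤ (⁺≤∣∣ c) (⁻≤∣∣ c')) ∣c∣+∣c'∣<q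
  y<q : c' ⁺ + c ⁻ < q
  y<q = ≤-<-trans (+-mono-≤ (⁺≤∣∣ c') (⁻≤∣∣ c)) (subst (_< q) (+-comm ℤ.∣ c ∣ ℤ.∣ c' ∣) ∣c∣+∣c'∣<q)

proposition4p4 : (b : ℕ) → 0 < b →
    (c c' : ℤ) (a a' : ℕ) → 1 ≤ a → a ≤ b → 1 ≤ a' → a' ≤ b →
    ¬ (∃ λ (n : ℕ) → c ℤ.* (+ b) ℤ.- (+ a) ≡ (+ n) ℤ.* (+ b)) →
    ¬ (∃ λ (n : ℕ) → c' ℤ.* (+ b) ℤ.- (+ a') ≡ (+ n) ℤ.* (+ b)) →
    (p : ℕ) → Prime p → p > b * (N b c a + N b c' a') + 1 → b ∣ (p ∸ 1) →
    (r r' : ℕ) →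
    RemP p (c ℤ.* (+ b) ℤ.- (+ a)) (+ b) r →
    RemP p (c' ℤ.* (+ b) ℤ.- (+ a')) (+ b) r' →
    (r < r' ⇔ (a < a' ⊎ (a ≡ a' × c ℤ.< c')))
proposition4p4 b _ c c' a a' 1≤a a≤b 1≤a' a'≤b γ∉ℕ γ'∉ℕ zero _ () _ r r' _ _
proposition4p4 b _ c c' a a' 1≤a a≤b 1≤a' a'≤b γ∉ℕ γ'∉ℕ (suc p') _ p>bM+1 (ℕ∣.divides q p'≡qb) r r' remP-r remP-r' =
  rem-<⇔lex a a' c c'
    (rem-γ b c a q (cong suc p'≡qb) 1≤a a≤b γ∉ℕ (≤-trans (m≤m+n (N b c a) (N b c' a')) (<⇒≤ M<q)) remP-r)
    (rem-γ b c' a' q (cong suc p'≡qb) 1≤a' a'≤b γ'∉ℕ (≤-trans (m≤n+m (N b c' a') (N b c a)) (<⇒≤ M<q)) remP-r')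
    (≤-<-trans (+-mono-≤ (∣∣≤N b c a) (∣∣≤N b c' a')) M<q)
  where
  M = N b c a + N b c' a'
  M<q : M < q
  M<q = *-cancelˡ-< b M q (subst (b * M <_) (trans p'≡qb (*-comm q b))
          (subst (_≤ p') (+-comm (b * M) 1) (s≤s⁻¹ p>bM+1)))
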